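{- Let $T$ be a tree and $j\ge 0$ an integer. Every subtree $H$ of $T$ that is a $j$-vine (respectively, a $j$-evine) is contained in a unique maximal subtree of $T$ that is a $j$-vine (respectively, a $j$-evine).
   Context: A $j$-vine is a tree of diameter $2j$; a $j$-evine is a tree of diameter $2j+1$. "Maximal" is with respect to containment among subtrees of $T$ that are $j$-vines (respectively $j$-evines). -}

module Defs where

open import Data.Nat using (ℕ; zero; suc; _≤_; _+_; _*_)
open import Data.Fin using (Fin)
open import Data.Fin.Subset using (Subset; _∈_; _⊆_; Nonempty) renaming (⊤ to full)
open import Data.List using (List; length; _++_; take)
open import Data.List.Relation.Unary.All using (All)
open import Data.List.Relation.Unary.Linked using (Linked)
open import Data.List.Relation.Unary.Unique.Propositional using (Unique)
open import Data.Product using (Σ; _×_; ∃)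
open import Relation.Binary.Core using (Rel)
open import Relation.Binary.Definitions using (Symmetric; Irreflexive; Decidable)
open import Relation.Binary.PropositionalEquality using (_≡_)
open import Relation.Nullary using (¬_)

record Graph (n : ℕ) : Set₁ where
  field
    Adj       : Rel (Fin n) _
    Adj-dec   : Decidable Adj
    Adj-sym   : Symmetric Adj
    Adj-irr   : Irreflexive _≡_ Adj
open Graph public

module _ {n : ℕ} (G : Graph n) where

  data Walk (S : Subset n) : Fin n → Fin n → ℕ → Set where
    here : ∀ {v} → v ∈ S → Walk S v v 0
    step : ∀ {u w v k} → u ∈ S → Adj G u w → Walk S w v k → Walk S u v (suc k)

  Connected : Subset n → Set
  Connected S = ∀ {u v} → u ∈ S → v ∈ S → ∃ λ k → Walk S u v k

  -- A cycle in the subgraph induced on S: distinct vertices v0,...,v_{m-1},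
  -- m ≥ 3, consecutive ones adjacent and v_{m-1} adjacent to v0.
  IsCycleIn : Subset n → List (Fin n) → Set
  IsCycleIn S c = 3 ≤ length c × Unique c × All (_∈ S) c × Linked (Adj G) (c ++ take 1 c)

  Acyclic : Subset n → Set
  Acyclic S = ∀ c → ¬ IsCycleIn S c

  -- The subgraph induced on S is a tree (a subtree of G, identified with its vertex set).
  IsSubtree : Subset n → Set
  IsSubtree S = Nonempty S × Connected S × Acyclic S

  Dist : Subset n → Fin n → Fin n → ℕ → Set
  Dist S u v d = Walk S u v d × (∀ k → Walk S u v k → d ≤ k)

  Diameter : Subset n → ℕ → Set
  Diameter S d =
    (Σ (Fin n) λ u → Σ (Fin n) λ v → u ∈ S × v ∈ S × Dist S u v d)
    × (∀ {u v} → u ∈ S → v ∈ S → ∃ λ k → k ≤ d × Walk S u v k)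

  IsVine : ℕ → Subset n → Set
  IsVine j S = IsSubtree S × Diameter S (2 * j)

  IsEvine : ℕ → Subset n → Set
  IsEvine j S = IsSubtree S × Diameter S (2 * j + 1)

IsTree : ∀ {n} → Graph n → Set
IsTree {n} G = IsSubtree G (full {n})

Maximal : ∀ {n} → (Subset n → Set) → Subset n → Set
Maximal P M = P M × (∀ M′ → P M′ → M ⊆ M′ → M′ ≡ M)

UniqueMaximalAbove : ∀ {n} → (Subset n → Set) → Subset n → Set
UniqueMaximalAbove P H =
  Σ _ λ M → (H ⊆ M × Maximal P M) × (∀ M′ → H ⊆ M′ → Maximal P M′ → M′ ≡ M)

-- Since paths in a tree are unique, the graph distance d is realised by a unique geodesic, and
-- the vertex set of a geodesic from u to v lies on every walk from u to v.  Fix a diametral pair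
-- a, b of the given vine (evine) H, so d(a,b) = D is its diameter.  Every subtree of diameter D
-- containing a and b lies in the lens L = {x | d(x,a) ≤ D and d(x,b) ≤ D}.  Balls in a tree are
-- convex, so L is a subtree.  For D = 2j the midpoint c of the geodesic from a to b satisfies
-- d(x,c) ≤ j on L; for D = 2j+1 every x ∈ L is within j of one of the two central vertices of
-- that geodesic.  Either way L has diameter D, so it is a vine (evine) containing every vine
-- (evine) through a and b: it is the unique maximal one above H.

module Submission where

open import Defs
open import Data.Empty using (⊥-elim)
open import Data.Fin using (Fin) renaming (_≟_ to _≟ᶠ_)
open import Data.Fin.Subset using (Subset; _∈_; _⊆_) renaming (⊤ to full)
open import Data.Fin.Subset.Properties using (∈⊤; ⊆-antisym)
open import Data.List using (List; []; _∷_; length; _++_)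
open import Data.List.Membership.Propositional using () renaming (_∈_ to _∈ₗ_)
import Data.List.Membership.DecPropositional as DecMembership
open import Data.List.Relation.Unary.All as All using ([])
open import Data.List.Relation.Unary.All.Properties using (¬Any⇒All¬)
open import Data.List.Relation.Unary.AllPairs using ([]; _∷_)
open import Data.List.Relation.Unary.Any using (here; there)
open import Data.List.Relation.Unary.Linked using (Linked; [-]; _∷_)
open import Data.List.Relation.Unary.Unique.Propositional using (Unique)
open import Data.Nat using (ℕ; suc; _≤_; _+_; _*_; z≤n; s≤s; _≤?_)
open import Data.Nat.Properties
open import Data.Nat.Tactic.RingSolver using (solve-∀)
open import Data.Product using (Σ; _×_; _,_; proj₁; proj₂)
open import Data.Sum using (_⊎_; inj₁; inj₂; [_,_]′)
open import Data.Unit using (⊤; tt)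
open import Data.Vec using (tabulate)
open import Data.Vec.Properties using (lookup∘tabulate; []=⇒lookup; lookup⇒[]=)
open import Function using (_∘_; id)
open import Relation.Binary.PropositionalEquality
open import Relation.Nullary using (¬_; yes; no; does)
open import Relation.Nullary.Decidable using (dec-true; _×-dec_)
open import Relation.Unary using (Decidable)

2*m≡m+m : ∀ m → 2 * m ≡ m + m
2*m≡m+m = solve-∀

2*m+1≡m+[1+m] : ∀ m → 2 * m + 1 ≡ m + suc m
2*m+1≡m+[1+m] = solve-∀

2*m+1≡[1+m]+m : ∀ m → 2 * m + 1 ≡ suc m + m
2*m+1≡[1+m]+m = solve-∀

module _ {n : ℕ} {P : Fin n → Set} (P? : Decidable P) where

  select : Subset n
  select = tabulate (does ∘ P?)

  ∈select⁺ : ∀ {x} → P x → x ∈ select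
  ∈select⁺ {x} px = lookup⇒[]= x select (trans (lookup∘tabulate _ x) (dec-true (P? x) px))

  ∈select⁻ : ∀ {x} → x ∈ select → P x
  ∈select⁻ {x} x∈ with P? x | trans (sym (lookup∘tabulate (does ∘ P?) x)) ([]=⇒lookup x∈)
  ... | yes px | _ = px
  ... | no _   | ()

module Walks {n : ℕ} (G : Graph n) where

  open DecMembership (_≟ᶠ_ {n}) using (_∈?_)

  infixr 5 _◅_ _◅◅_
  infix 4 _∈ᵥ_ _∉ᵥ_

  data _⇝_ : Fin n → Fin n → Set where
    ε   : ∀ {v} → v ⇝ v
    _◅_ : ∀ {u w v} → Adj G u w → w ⇝ v → u ⇝ v

  private variable
    u v w x y : Fin n

  steps : u ⇝ v → ℕ
  steps ε       = 0
  steps (_ ◅ p) = suc (steps p)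

  vertices : u ⇝ v → List (Fin n)
  vertices {u} ε       = u ∷ []
  vertices {u} (_ ◅ p) = u ∷ vertices p

  _∈ᵥ_ : Fin n → u ⇝ v → Set
  x ∈ᵥ p = x ∈ₗ vertices p

  _∉ᵥ_ : Fin n → u ⇝ v → Set
  x ∉ᵥ p = ¬ x ∈ᵥ p

  IsPath : u ⇝ v → Set
  IsPath ε           = ⊤
  IsPath {u} (_ ◅ p) = u ∉ᵥ p × IsPath p

  _◅◅_ : u ⇝ v → v ⇝ w → u ⇝ w
  ε       ◅◅ q = q
  (e ◅ p) ◅◅ q = e ◅ (p ◅◅ q)

  ◅◅-assoc : (p : u ⇝ v) (q : v ⇝ w) (r : w ⇝ x) → (p ◅◅ q) ◅◅ r ≡ p ◅◅ (q ◅◅ r)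
  ◅◅-assoc ε       q r = refl
  ◅◅-assoc (e ◅ p) q r = cong (e ◅_) (◅◅-assoc p q r)

  steps-◅◅ : (p : u ⇝ v) (q : v ⇝ w) → steps (p ◅◅ q) ≡ steps p + steps q
  steps-◅◅ ε       q = refl
  steps-◅◅ (e ◅ p) q = cong suc (steps-◅◅ p q)

  length-vertices : (p : u ⇝ v) → length (vertices p) ≡ suc (steps p)
  length-vertices ε       = refl
  length-vertices (_ ◅ p) = cong suc (length-vertices p)

  start∈ᵥ : (p : u ⇝ v) → u ∈ᵥ p
  start∈ᵥ ε       = here refl
  start∈ᵥ (_ ◅ _) = here refl

  end∈ᵥ : (p : u ⇝ v) → v ∈ᵥ p
  end∈ᵥ ε       = here refl
  end∈ᵥ (_ ◅ p) = there (end∈ᵥ p)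

  ∈ᵥ-◅◅⁻ : (p : u ⇝ v) (q : v ⇝ w) → x ∈ᵥ p ◅◅ q → x ∈ᵥ p ⊎ x ∈ᵥ q
  ∈ᵥ-◅◅⁻ ε       q x∈           = inj₂ x∈
  ∈ᵥ-◅◅⁻ (e ◅ p) q (here x≡u)   = inj₁ (here x≡u)
  ∈ᵥ-◅◅⁻ (e ◅ p) q (there x∈) with ∈ᵥ-◅◅⁻ p q x∈
  ... | inj₁ x∈p = inj₁ (there x∈p)
  ... | inj₂ x∈q = inj₂ x∈q

  ∈ᵥ-◅◅⁺ˡ : (p : u ⇝ v) (q : v ⇝ w) → x ∈ᵥ p → x ∈ᵥ p ◅◅ q
  ∈ᵥ-◅◅⁺ˡ ε       q (here refl) = start∈ᵥ q
  ∈ᵥ-◅◅⁺ˡ (e ◅ p) q (here x≡u)  = here x≡u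
  ∈ᵥ-◅◅⁺ˡ (e ◅ p) q (there x∈)  = there (∈ᵥ-◅◅⁺ˡ p q x∈)

  ∈ᵥ-◅◅⁺ʳ : (p : u ⇝ v) (q : v ⇝ w) → x ∈ᵥ q → x ∈ᵥ p ◅◅ q
  ∈ᵥ-◅◅⁺ʳ ε       q x∈ = x∈
  ∈ᵥ-◅◅⁺ʳ (e ◅ p) q x∈ = there (∈ᵥ-◅◅⁺ʳ p q x∈)

  reverse : u ⇝ v → v ⇝ u
  reverse ε       = ε
  reverse (e ◅ p) = reverse p ◅◅ (Adj-sym G e ◅ ε)

  steps-reverse : (p : u ⇝ v) → steps (reverse p) ≡ steps p
  steps-reverse ε       = refl
  steps-reverse (e ◅ p) = begin
    steps (reverse p ◅◅ (Adj-sym G e ◅ ε)) ≡⟨ steps-◅◅ (reverse p) _ ⟩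
    steps (reverse p) + 1                  ≡⟨ +-comm (steps (reverse p)) 1 ⟩
    suc (steps (reverse p))                ≡⟨ cong suc (steps-reverse p) ⟩
    suc (steps p)                          ∎
    where open ≡-Reasoning

  ∈ᵥ-reverse⁻ : (p : u ⇝ v) → x ∈ᵥ reverse p → x ∈ᵥ p
  ∈ᵥ-reverse⁻ ε x∈ = x∈
  ∈ᵥ-reverse⁻ (e ◅ p) x∈ with ∈ᵥ-◅◅⁻ (reverse p) _ x∈
  ... | inj₁ x∈p                 = there (∈ᵥ-reverse⁻ p x∈p)
  ... | inj₂ (here refl)         = there (start∈ᵥ p)
  ... | inj₂ (there (here refl)) = here refl

  IsPath-◅◅⁻ : (p : u ⇝ v) (q : v ⇝ w) → IsPath (p ◅◅ q) → IsPath p × IsPath q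
  IsPath-◅◅⁻ ε       q q-path            = tt , q-path
  IsPath-◅◅⁻ (e ◅ p) q (u∉pq , pq-path) =
    (u∉pq ∘ ∈ᵥ-◅◅⁺ˡ p q , proj₁ (IsPath-◅◅⁻ p q pq-path)) , proj₂ (IsPath-◅◅⁻ p q pq-path)

  split-at-vertex : (p : u ⇝ v) → x ∈ᵥ p → Σ (u ⇝ x) λ p₁ → Σ (x ⇝ v) λ p₂ → p₁ ◅◅ p₂ ≡ p
  split-at-vertex ε       (here refl) = ε , ε , refl
  split-at-vertex (e ◅ p) (here refl) = ε , e ◅ p , refl
  split-at-vertex (e ◅ p) (there x∈) =
    let (p₁ , p₂ , p₁◅◅p₂≡p) = split-at-vertex p x∈ in e ◅ p₁ , p₂ , cong (e ◅_) p₁◅◅p₂≡p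

  split-at-step : (p : u ⇝ v) (m : ℕ) → m ≤ steps p →
    Σ (Fin n) λ x → Σ (u ⇝ x) λ p₁ → Σ (x ⇝ v) λ p₂ → steps p₁ ≡ m × p₁ ◅◅ p₂ ≡ p
  split-at-step p       0       _         = _ , ε , p , refl , refl
  split-at-step (e ◅ p) (suc m) (s≤s m≤) =
    let (x , p₁ , p₂ , steps-p₁ , p₁◅◅p₂≡p) = split-at-step p m m≤
    in x , e ◅ p₁ , p₂ , cong suc steps-p₁ , cong (e ◅_) p₁◅◅p₂≡p

  split-at-edge : (p : u ⇝ v) (m : ℕ) → suc m ≤ steps p →
    Σ (Fin n) λ x → Σ (Fin n) λ y → Σ (u ⇝ x) λ p₁ → Σ (Adj G x y) λ e → Σ (y ⇝ v) λ p₂ →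
      steps p₁ ≡ m × p₁ ◅◅ (e ◅ p₂) ≡ p
  split-at-edge (e ◅ p) 0       _         = _ , _ , ε , e , p , refl , refl
  split-at-edge (e ◅ p) (suc m) (s≤s m<) =
    let (x , y , p₁ , f , p₂ , steps-p₁ , p₁◅◅fp₂≡p) = split-at-edge p m m<
    in x , y , e ◅ p₁ , f , p₂ , cong suc steps-p₁ , cong (e ◅_) p₁◅◅fp₂≡p

  ShorterPath : u ⇝ v → Set
  ShorterPath {u} {v} p =
    Σ (u ⇝ v) λ q → IsPath q × steps q ≤ steps p × (∀ {x} → x ∈ᵥ q → x ∈ᵥ p)

  walk⇒path : (p : u ⇝ v) → ShorterPath p
  walk⇒path ε = ε , tt , z≤n , λ x∈ → x∈
  walk⇒path (_◅_ {u} e p) with walk⇒path p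
  ... | q , q-path , q≤p , q⊆p with u ∈? vertices q
  ...   | no u∉q =
    e ◅ q , (u∉q , q-path) , s≤s q≤p , λ { (here x≡u) → here x≡u ; (there x∈) → there (q⊆p x∈) }
  ...   | yes u∈q with split-at-vertex q u∈q
  ...     | q₁ , q₂ , refl =
    q₂ , proj₂ (IsPath-◅◅⁻ q₁ q₂ q-path) ,
    m≤n⇒m≤1+n (≤-trans (subst (steps q₂ ≤_) (sym (steps-◅◅ q₁ q₂)) (m≤n+m _ _)) q≤p) ,
    there ∘ q⊆p ∘ ∈ᵥ-◅◅⁺ʳ q₁ q₂

  IsPath⇒Unique : (p : u ⇝ v) → IsPath p → Unique (vertices p)
  IsPath⇒Unique ε       _               = [] ∷ []
  IsPath⇒Unique (e ◅ p) (u∉p , p-path) = ¬Any⇒All¬ (vertices p) u∉p ∷ IsPath⇒Unique p p-path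

  linked-between : Adj G x u → (p : u ⇝ v) → Adj G v y → Linked (Adj G) (x ∷ vertices p ++ y ∷ [])
  linked-between e ε       e′ = e ∷ e′ ∷ [-]
  linked-between e (f ◅ p) e′ = e ∷ linked-between f p e′

  cycle-through : Adj G x u → (p : u ⇝ w) → Adj G w x → IsPath p → x ∉ᵥ p → ¬ u ≡ w →
    IsCycleIn G full (x ∷ vertices p)
  cycle-through e p e′ p-path x∉p u≢w =
    three-vertices p u≢w , ¬Any⇒All¬ (vertices p) x∉p ∷ IsPath⇒Unique p p-path ,
    All.tabulate (λ _ → ∈⊤) , linked-between e p e′
    where
      three-vertices : (p : u ⇝ w) → ¬ u ≡ w → 3 ≤ suc (length (vertices p))
      three-vertices ε       u≢u = ⊥-elim (u≢u refl)
      three-vertices (_ ◅ p) _   = subst (3 ≤_) (cong (2 +_) (sym (length-vertices p))) (s≤s (s≤s (s≤s z≤n)))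

  fromWalk : ∀ {S k} → Walk G S u v k → Σ (u ⇝ v) λ p → steps p ≡ k × (∀ {x} → x ∈ᵥ p → x ∈ S)
  fromWalk (here v∈) = ε , refl , λ { (here refl) → v∈ }
  fromWalk (step u∈ e w) =
    let (p , steps-p , p⊆S) = fromWalk w
    in e ◅ p , cong suc steps-p , λ { (here refl) → u∈ ; (there x∈) → p⊆S x∈ }

  toWalk : ∀ {S} (p : u ⇝ v) → (∀ {x} → x ∈ᵥ p → x ∈ S) → Walk G S u v (steps p)
  toWalk ε       p⊆S = here (p⊆S (here refl))
  toWalk (e ◅ p) p⊆S = step (p⊆S (here refl)) e (toWalk p (p⊆S ∘ there))

module Tree {n : ℕ} (G : Graph n) (tree : IsTree G) where

  open Walks G
  open DecMembership (_≟ᶠ_ {n}) using (_∈?_)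

  private variable
    a b c u v x y z : Fin n

  acyclic : ∀ {S} → Acyclic G S
  acyclic c (3≤ , unique , _ , linked) =
    proj₂ (proj₂ tree) c (3≤ , unique , All.tabulate (λ _ → ∈⊤) , linked)

  paths-unique : (p q : u ⇝ v) → IsPath p → IsPath q → vertices p ≡ vertices q
  paths-unique ε       ε       _          _          = refl
  paths-unique ε       (_ ◅ q) _          (u∉q , _) = ⊥-elim (u∉q (end∈ᵥ q))
  paths-unique (_ ◅ p) ε       (u∉p , _) _          = ⊥-elim (u∉p (end∈ᵥ p))
  paths-unique (_◅_ {u} {w₁} e₁ p) (_◅_ {w = w₂} e₂ q) (u∉p , p-path) (u∉q , q-path) with w₁ ≟ᶠ w₂
  ... | yes refl = cong (u ∷_) (paths-unique p q p-path q-path)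
  ... | no w₁≢w₂ with walk⇒path (p ◅◅ reverse q)
  ...   | r , r-path , _ , r⊆ =
    ⊥-elim (acyclic (u ∷ vertices r) (cycle-through e₁ r (Adj-sym G e₂) r-path u∉r w₁≢w₂))
    where
      u∉r : u ∉ᵥ r
      u∉r = [ u∉p , u∉q ∘ ∈ᵥ-reverse⁻ q ]′ ∘ ∈ᵥ-◅◅⁻ p (reverse q) ∘ r⊆

  private
    some-path : (u v : Fin n) → Σ (u ⇝ v) IsPath
    some-path u v =
      let (_ , w)          = proj₁ (proj₂ tree) (∈⊤ {x = u}) (∈⊤ {x = v})
          (q , q-path , _) = walk⇒path (proj₁ (fromWalk w))
      in q , q-path

  path : (u v : Fin n) → u ⇝ v
  path u v = proj₁ (some-path u v)

  path-isPath : (u v : Fin n) → IsPath (path u v)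
  path-isPath u v = proj₂ (some-path u v)

  dist : Fin n → Fin n → ℕ
  dist u v = steps (path u v)

  steps≡dist : (p : u ⇝ v) → IsPath p → steps p ≡ dist u v
  steps≡dist {u} {v} p p-path = suc-injective (begin
    suc (steps p)                ≡⟨ length-vertices p ⟨
    length (vertices p)          ≡⟨ cong length (paths-unique p (path u v) p-path (path-isPath u v)) ⟩
    length (vertices (path u v)) ≡⟨ length-vertices (path u v) ⟩
    suc (dist u v)               ∎)
    where open ≡-Reasoning

  dist≤steps : (p : u ⇝ v) → dist u v ≤ steps p
  dist≤steps p =
    let (q , q-path , q≤p , _) = walk⇒path p in subst (_≤ steps p) (steps≡dist q q-path) q≤p

  path⊆walk : (p : u ⇝ v) → x ∈ᵥ path u v → x ∈ᵥ p
  path⊆walk {u} {v} p x∈ =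
    let (q , q-path , _ , q⊆p) = walk⇒path p
    in q⊆p (subst (_ ∈ₗ_) (paths-unique (path u v) q (path-isPath u v) q-path) x∈)

  dist-refl : dist u u ≡ 0
  dist-refl {u} = n≤0⇒n≡0 (dist≤steps (ε {u}))

  dist-sym : ∀ u v → dist u v ≡ dist v u
  dist-sym u v = ≤-antisym (reversed (path v u)) (reversed (path u v))
    where
      reversed : ∀ {u v} (p : v ⇝ u) → dist u v ≤ steps p
      reversed p = subst (_ ≤_) (steps-reverse p) (dist≤steps (reverse p))

  dist-triangle : ∀ u v w → dist u w ≤ dist u v + dist v w
  dist-triangle u v w =
    subst (dist u w ≤_) (steps-◅◅ (path u v) (path v w)) (dist≤steps (path u v ◅◅ path v w))

  pieces-are-paths : (p₁ : a ⇝ c) (p₂ : c ⇝ b) → p₁ ◅◅ p₂ ≡ path a b → IsPath p₁ × IsPath p₂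
  pieces-are-paths {a} {b = b} p₁ p₂ eq = IsPath-◅◅⁻ p₁ p₂ (subst IsPath (sym eq) (path-isPath a b))

  geodesic-split : (p₁ : a ⇝ c) (p₂ : c ⇝ b) → p₁ ◅◅ p₂ ≡ path a b →
    c ∈ᵥ path a b × dist a c ≡ steps p₁ × dist c b ≡ steps p₂
  geodesic-split p₁ p₂ eq =
    let (p₁-path , p₂-path) = pieces-are-paths p₁ p₂ eq
    in subst (_ ∈ᵥ_) eq (∈ᵥ-◅◅⁺ʳ p₁ p₂ (start∈ᵥ p₂)) ,
       sym (steps≡dist p₁ p₁-path) , sym (steps≡dist p₂ p₂-path)

  dist-split : x ∈ᵥ path u v → dist u v ≡ dist u x + dist x v
  dist-split {u = u} {v} x∈ =
    let (p₁ , p₂ , eq)        = split-at-vertex (path u v) x∈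
        (_ , d₁≡p₁ , d₂≡p₂) = geodesic-split p₁ p₂ eq
    in begin
      dist u v                 ≡⟨ cong steps eq ⟨
      steps (p₁ ◅◅ p₂)         ≡⟨ steps-◅◅ p₁ p₂ ⟩
      steps p₁ + steps p₂      ≡⟨ cong₂ _+_ d₁≡p₁ d₂≡p₂ ⟨
      dist u _ + dist _ v      ∎
    where open ≡-Reasoning

  dist-prefix≤ : x ∈ᵥ path u v → dist u x ≤ dist u v
  dist-prefix≤ x∈ = subst (_ ≤_) (sym (dist-split x∈)) (m≤m+n _ _)

  dist-suffix≤ : x ∈ᵥ path u v → dist x v ≤ dist u v
  dist-suffix≤ x∈ = subst (_ ≤_) (sym (dist-split x∈)) (m≤n+m _ _)

  dist-from≤ : ∀ {r} → x ∈ᵥ path u v → dist u v ≤ dist u x + r → dist x v ≤ r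
  dist-from≤ {x} {u} {v} {r} x∈ le = +-cancelˡ-≤ (dist u x) _ _ (subst (_≤ dist u x + r) (dist-split x∈) le)

  dist-to≤ : ∀ {r} → x ∈ᵥ path u v → dist u v ≤ r + dist x v → dist u x ≤ r
  dist-to≤ {x} {u} {v} {r} x∈ le = +-cancelʳ-≤ (dist x v) _ _ (subst (_≤ r + dist x v) (dist-split x∈) le)

  dist-neighbour : Adj G y x → x ∈ᵥ path u v → y ∉ᵥ path u v → dist y v ≡ suc (dist x v)
  dist-neighbour {y} {x} {u} {v} e x∈ y∉ with split-at-vertex (path u v) x∈
  ... | p₁ , p₂ , p₁◅◅p₂ = begin
    dist y v         ≡⟨ steps≡dist (e ◅ p₂) (y∉p₂ , p₂-path) ⟨
    suc (steps p₂)   ≡⟨ cong suc (steps≡dist p₂ p₂-path) ⟩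
    suc (dist x v)   ∎
    where
      open ≡-Reasoning
      p₂-path : IsPath p₂
      p₂-path = proj₂ (pieces-are-paths p₁ p₂ p₁◅◅p₂)
      y∉p₂ : y ∉ᵥ p₂
      y∉p₂ = y∉ ∘ subst (y ∈ᵥ_) p₁◅◅p₂ ∘ ∈ᵥ-◅◅⁺ʳ p₁ p₂

  path-detour : ∀ w → x ∈ᵥ path u v → x ∈ᵥ path u w ⊎ x ∈ᵥ path w v
  path-detour {u = u} {v} w x∈ = ∈ᵥ-◅◅⁻ (path u w) (path w v) (path⊆walk (path u w ◅◅ path w v) x∈)

  ball-convex : ∀ {r} → z ∈ᵥ path x y → dist x c ≤ r → dist y c ≤ r → dist z c ≤ r
  ball-convex {z} {x} {y} {c} z∈ xc≤ yc≤ with path-detour c z∈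
  ... | inj₁ z∈xc = ≤-trans (dist-suffix≤ z∈xc) xc≤
  ... | inj₂ z∈cy =
    subst (_≤ _) (dist-sym c z) (≤-trans (dist-prefix≤ z∈cy) (subst (_≤ _) (dist-sym y c) yc≤))

  near-path-vertex : ∀ {r} → c ∈ᵥ path a b → dist x a ≤ dist a c + r → dist x b ≤ r + dist c b → dist x c ≤ r
  near-path-vertex {c} {a} {b} {x} c∈ xa≤ xb≤ with path-detour x c∈
  ... | inj₁ c∈ax = subst (_≤ _) (dist-sym c x) (dist-from≤ c∈ax (subst (_≤ _) (dist-sym x a) xa≤))
  ... | inj₂ c∈xb = dist-to≤ c∈xb xb≤

  Walk⇒dist≤ : ∀ {S k} → Walk G S u v k → dist u v ≤ k
  Walk⇒dist≤ {u} {v} w = let (p , steps-p , _) = fromWalk w in subst (dist u v ≤_) steps-p (dist≤steps p)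

  Dist⇒dist : ∀ {S k} → Dist G S u v k → dist u v ≡ k
  Dist⇒dist {u} {v} (w , minimal) =
    let (p , _ , p⊆S) = fromWalk w
    in ≤-antisym (Walk⇒dist≤ w) (minimal (dist u v) (toWalk (path u v) (p⊆S ∘ path⊆walk p)))

  SubtreeOfDiameter : ℕ → Subset n → Set
  SubtreeOfDiameter D S = IsSubtree G S × Diameter G S D

  module Lens (D : ℕ) (a b : Fin n) (dist-ab : dist a b ≡ D) where

    InLens : Fin n → Set
    InLens x = dist x a ≤ D × dist x b ≤ D

    InLens? : Decidable InLens
    InLens? x = (dist x a ≤? D) ×-dec (dist x b ≤? D)

    lens : Subset n
    lens = select InLens?

    ∈lens⁺ : InLens x → x ∈ lens
    ∈lens⁺ = ∈select⁺ InLens?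

    ∈lens⁻ : x ∈ lens → InLens x
    ∈lens⁻ = ∈select⁻ InLens?

    a∈lens : a ∈ lens
    a∈lens = ∈lens⁺ (subst (_≤ D) (sym dist-refl) z≤n , ≤-reflexive dist-ab)

    b∈lens : b ∈ lens
    b∈lens = ∈lens⁺ (≤-reflexive (trans (dist-sym b a) dist-ab) , subst (_≤ D) (sym dist-refl) z≤n)

    lens-convex : InLens x → InLens y → z ∈ᵥ path x y → InLens z
    lens-convex (xa≤ , xb≤) (ya≤ , yb≤) z∈ = ball-convex z∈ xa≤ ya≤ , ball-convex z∈ xb≤ yb≤

    path-in-lens : x ∈ lens → y ∈ lens → Walk G lens x y (dist x y)
    path-in-lens x∈ y∈ = toWalk (path _ _) (∈lens⁺ ∘ lens-convex (∈lens⁻ x∈) (∈lens⁻ y∈))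

    diameter⇒⊆lens : ∀ {S} → Diameter G S D → a ∈ S → b ∈ S → S ⊆ lens
    diameter⇒⊆lens (_ , bounded) a∈ b∈ x∈ = ∈lens⁺ (within a∈ , within b∈)
      where
        within : ∀ {y} → y ∈ _ → dist _ y ≤ D
        within y∈ = let (_ , k≤D , w) = bounded x∈ y∈ in ≤-trans (Walk⇒dist≤ w) k≤D

    LensBounded : Set
    LensBounded = ∀ {x y} → InLens x → InLens y → dist x y ≤ D

    bounded-by-centres : ∀ {c₁ c₂} j → j + (dist c₁ c₂ + j) ≤ D →
      (∀ {x} → InLens x → dist x c₁ ≤ j ⊎ dist x c₂ ≤ j) → LensBounded
    bounded-by-centres {c₁} {c₂} j bound near {x} {y} x∈ y∈ = ≤-trans (hop (near x∈) (near y∈)) bound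
      where
        via : ∀ {c c′} → dist x c ≤ j → dist y c′ ≤ j → dist c c′ ≤ dist c₁ c₂ →
          dist x y ≤ j + (dist c₁ c₂ + j)
        via {c} {c′} xc≤ yc′≤ cc′≤ = begin
          dist x y                           ≤⟨ dist-triangle x c y ⟩
          dist x c + dist c y                ≤⟨ +-monoʳ-≤ (dist x c) (dist-triangle c c′ y) ⟩
          dist x c + (dist c c′ + dist c′ y) ≤⟨ +-mono-≤ xc≤ (+-mono-≤ cc′≤ (subst (_≤ j) (dist-sym y c′) yc′≤)) ⟩
          j + (dist c₁ c₂ + j)               ∎
          where open ≤-Reasoning

        hop : dist x c₁ ≤ j ⊎ dist x c₂ ≤ j → dist y c₁ ≤ j ⊎ dist y c₂ ≤ j →
          dist x y ≤ j + (dist c₁ c₂ + j)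
        hop (inj₁ xc≤) (inj₁ yc≤) = via xc≤ yc≤ (subst (_≤ dist c₁ c₂) (sym (dist-refl {c₁})) z≤n)
        hop (inj₁ xc≤) (inj₂ yc≤) = via xc≤ yc≤ ≤-refl
        hop (inj₂ xc≤) (inj₁ yc≤) = via xc≤ yc≤ (≤-reflexive (dist-sym c₂ c₁))
        hop (inj₂ xc≤) (inj₂ yc≤) = via xc≤ yc≤ (subst (_≤ dist c₁ c₂) (sym (dist-refl {c₂})) z≤n)

    module _ (lens-bounded : LensBounded) where

      lens-subtree : IsSubtree G lens
      lens-subtree = (a , a∈lens) , (λ x∈ y∈ → _ , path-in-lens x∈ y∈) , acyclic

      lens-diameter : Diameter G lens D
      lens-diameter =
        (a , b , a∈lens , b∈lens , subst (Walk G lens a b) dist-ab (path-in-lens a∈lens b∈lens) ,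
          λ k w → subst (_≤ k) dist-ab (Walk⇒dist≤ w)) ,
        λ x∈ y∈ → _ , lens-bounded (∈lens⁻ x∈) (∈lens⁻ y∈) , path-in-lens x∈ y∈

      unique-maximal : ∀ H → Diameter G H D → a ∈ H → b ∈ H →
        UniqueMaximalAbove (SubtreeOfDiameter D) H
      unique-maximal H H-diam a∈H b∈H =
        lens , (diameter⇒⊆lens H-diam a∈H b∈H , lens-vine , lens-maximal) , only-maximal
        where
          lens-vine : SubtreeOfDiameter D lens
          lens-vine = lens-subtree , lens-diameter

          lens-maximal : ∀ S → SubtreeOfDiameter D S → lens ⊆ S → S ≡ lens
          lens-maximal S (_ , S-diam) lens⊆S =
            ⊆-antisym (diameter⇒⊆lens S-diam (lens⊆S a∈lens) (lens⊆S b∈lens)) lens⊆S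

          only-maximal : ∀ S → H ⊆ S → Maximal (SubtreeOfDiameter D) S → S ≡ lens
          only-maximal S H⊆S ((_ , S-diam) , S-maximal) =
            sym (S-maximal lens lens-vine (diameter⇒⊆lens S-diam (H⊆S a∈H) (H⊆S b∈H)))

  vine-lens-bounded : ∀ j → (dist-ab : dist a b ≡ 2 * j) → Lens.LensBounded (2 * j) a b dist-ab
  vine-lens-bounded {a} {b} j dist-ab
    with split-at-step (path a b) j (subst (j ≤_) (sym dist-ab) (m≤m+n j _))
  ... | c , p₁ , p₂ , steps-p₁ , p₁◅◅p₂ with geodesic-split p₁ p₂ p₁◅◅p₂
  ...   | c∈ab , dist-ac≡ , _ =
    bounded-by-centres {c} {c} j (≤-reflexive centre-bound) (inj₁ ∘ near)
    where
      open Lens (2 * j) a b dist-ab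
      open ≡-Reasoning

      double : 2 * j ≡ j + j
      double = 2*m≡m+m j

      dist-ac : dist a c ≡ j
      dist-ac = trans dist-ac≡ steps-p₁

      dist-cb : dist c b ≡ j
      dist-cb = +-cancelˡ-≡ j _ _ (begin
        j + dist c b        ≡⟨ cong (_+ dist c b) dist-ac ⟨
        dist a c + dist c b ≡⟨ dist-split c∈ab ⟨
        dist a b            ≡⟨ trans dist-ab double ⟩
        j + j               ∎)

      centre-bound : j + (dist c c + j) ≡ 2 * j
      centre-bound = trans (cong (λ k → j + (k + j)) dist-refl) (sym double)

      near : ∀ {x} → InLens x → dist x c ≤ j
      near {x} (xa≤ , xb≤) = near-path-vertex c∈ab
        (subst (dist x a ≤_) (trans double (cong (_+ j) (sym dist-ac))) xa≤)
        (subst (dist x b ≤_) (trans double (cong (j +_) (sym dist-cb))) xb≤)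

  -- The central edge c₁c₂ of the geodesic from a to b has dist a c₁ = dist c₂ b = j.  A lens vertex x
  -- is near c₂ if the geodesic from a to x passes c₂, and near c₁ if the one from x to b passes c₁;
  -- otherwise the geodesic from c₂ to x runs through c₁, and dist x c₂ ≤ j + 1 gives dist x c₁ ≤ j.
  evine-lens-bounded : ∀ j → (dist-ab : dist a b ≡ 2 * j + 1) → Lens.LensBounded (2 * j + 1) a b dist-ab
  evine-lens-bounded {a} {b} j dist-ab
    with split-at-edge (path a b) j (subst (suc j ≤_) (sym (trans dist-ab (2*m+1≡[1+m]+m j))) (m≤m+n _ j))
  ... | c₁ , c₂ , p₁ , e , p₂ , steps-p₁ , p₁◅◅ep₂
    with geodesic-split p₁ (e ◅ p₂) p₁◅◅ep₂
       | geodesic-split (p₁ ◅◅ (e ◅ ε)) p₂ (trans (◅◅-assoc p₁ (e ◅ ε) p₂) p₁◅◅ep₂)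
  ... | c₁∈ab , dist-ac₁≡ , dist-c₁b≡ | c₂∈ab , dist-ac₂≡ , dist-c₂b≡ = bounded-by-centres j centre-bound near
    where
      open Lens (2 * j + 1) a b dist-ab
      open ≡-Reasoning

      odd₁ : 2 * j + 1 ≡ j + suc j
      odd₁ = 2*m+1≡m+[1+m] j

      odd₂ : 2 * j + 1 ≡ suc j + j
      odd₂ = 2*m+1≡[1+m]+m j

      dist-ac₁ : dist a c₁ ≡ j
      dist-ac₁ = trans dist-ac₁≡ steps-p₁

      dist-ac₂ : dist a c₂ ≡ suc j
      dist-ac₂ = begin
        dist a c₂               ≡⟨ dist-ac₂≡ ⟩
        steps (p₁ ◅◅ (e ◅ ε))   ≡⟨ steps-◅◅ p₁ (e ◅ ε) ⟩
        steps p₁ + 1            ≡⟨ cong (_+ 1) steps-p₁ ⟩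
        j + 1                   ≡⟨ +-comm j 1 ⟩
        suc j                   ∎

      dist-c₁b≡suc : dist c₁ b ≡ suc (dist c₂ b)
      dist-c₁b≡suc = trans dist-c₁b≡ (cong suc (sym dist-c₂b≡))

      dist-c₂b : dist c₂ b ≡ j
      dist-c₂b = suc-injective (+-cancelˡ-≡ j _ _ (begin
        j + suc (dist c₂ b)     ≡⟨ cong₂ _+_ dist-ac₁ dist-c₁b≡suc ⟨
        dist a c₁ + dist c₁ b   ≡⟨ dist-split c₁∈ab ⟨
        dist a b                ≡⟨ trans dist-ab odd₁ ⟩
        j + suc j               ∎))

      dist-c₁b : dist c₁ b ≡ suc j
      dist-c₁b = trans dist-c₁b≡suc (cong suc dist-c₂b)

      centre-bound : j + (dist c₁ c₂ + j) ≤ 2 * j + 1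
      centre-bound =
        subst (j + (dist c₁ c₂ + j) ≤_) (sym odd₁) (+-monoʳ-≤ j (+-monoˡ-≤ j (dist≤steps (e ◅ ε))))

      near : ∀ {x} → InLens x → dist x c₁ ≤ j ⊎ dist x c₂ ≤ j
      near {x} (xa≤ , xb≤) with c₂ ∈? vertices (path a x)
      ... | yes c₂∈ax = inj₂ (subst (_≤ j) (dist-sym c₂ x) (dist-from≤ c₂∈ax ax≤))
        where
          ax≤ : dist a x ≤ dist a c₂ + j
          ax≤ = subst₂ _≤_ (dist-sym x a) (trans odd₂ (cong (_+ j) (sym dist-ac₂))) xa≤
      ... | no c₂∉ax with path-detour x c₁∈ab
      ...   | inj₂ c₁∈xb =
        inj₁ (dist-to≤ c₁∈xb (subst (dist x b ≤_) (trans odd₁ (cong (j +_) (sym dist-c₁b))) xb≤))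
      ...   | inj₁ c₁∈ax = inj₁ (subst (_≤ j) (dist-sym c₁ x) (≤-pred (subst (_≤ suc j) xc₂≡ xc₂≤)))
        where
          c₂∈xb : c₂ ∈ᵥ path x b
          c₂∈xb = [ ⊥-elim ∘ c₂∉ax , id ]′ (path-detour x c₂∈ab)

          xc₂≤ : dist x c₂ ≤ suc j
          xc₂≤ = dist-to≤ c₂∈xb (subst (dist x b ≤_) (trans odd₂ (cong (suc j +_) (sym dist-c₂b))) xb≤)

          xc₂≡ : dist x c₂ ≡ suc (dist c₁ x)
          xc₂≡ = trans (dist-sym x c₂) (dist-neighbour (Adj-sym G e) c₁∈ax c₂∉ax)

lemma2p3 : ∀ {n} (T : Graph n) → IsTree T → (j : ℕ) → (H : Subset n) →
    (IsVine T j H → UniqueMaximalAbove (IsVine T j) H)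
    × (IsEvine T j H → UniqueMaximalAbove (IsEvine T j) H)
lemma2p3 T tree j H = vine , evine
  where
    open Tree T tree

    vine : IsVine T j H → UniqueMaximalAbove (IsVine T j) H
    vine (_ , H-diam@((a , b , a∈H , b∈H , ab-dist) , _)) =
      let dist-ab = Dist⇒dist ab-dist
      in Lens.unique-maximal (2 * j) a b dist-ab (vine-lens-bounded j dist-ab) H H-diam a∈H b∈H

    evine : IsEvine T j H → UniqueMaximalAbove (IsEvine T j) H
    evine (_ , H-diam@((a , b , a∈H , b∈H , ab-dist) , _)) =
      let dist-ab = Dist⇒dist ab-dist
      in Lens.unique-maximal (2 * j + 1) a b dist-ab (evine-lens-bounded j dist-ab) H H-diam a∈H b∈H
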